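{- Let $k \ge 3$ be an odd integer and let $D$ be a $k$-quasi-transitive digraph. If $P = (u_0, u_1, \dots, u_{k+2})$ is a $u_0u_{k+2}$-path of minimum length in $D$ (so $d(u_0,u_{k+2}) = k+2$), then $(u_{k+2}, w) \in A(D)$ for every $w \in V(D)$ such that $n = d(u_0, w)$ is even and $n \le k-1$.
   Context: All digraphs are finite, without loops and without multiple arcs in the same direction; paths are directed. $d(u,v)$ is the length of a shortest directed $uv$-path ($d(v,v)=0$). $D$ is $k$-quasi-transitive if for every directed path $(v_0, \dots, v_k)$ of length $k$, $(v_0,v_k) \in A(D)$ or $(v_k,v_0) \in A(D)$. -}

module Defs where

open import Data.Nat using (ℕ; zero; suc; _+_; _*_; _≤_; _<_)
open import Data.Fin using (Fin; inject₁; fromℕ; toℕ)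
open import Data.Product using (Σ; _×_; _,_; ∃)
open import Data.Sum using (_⊎_)
open import Relation.Nullary using (¬_)
open import Relation.Binary.PropositionalEquality using (_≡_; _≢_)
open import Function.Definitions using (Injective)

record Digraph : Set₁ where
  field
    n       : ℕ
    Arc     : Fin n → Fin n → Set
    loopless : ∀ v → ¬ Arc v v
open Digraph public

Vertex : Digraph → Set
Vertex D = Fin (n D)

IsWalk : (D : Digraph) (m : ℕ) → (Fin (suc m) → Vertex D) → Set
IsWalk D m p = (i : Fin m) → Arc D (p (inject₁ i)) (p (Data.Fin.suc i))

IsPath : (D : Digraph) (m : ℕ) → (Fin (suc m) → Vertex D) → Set
IsPath D m p = IsWalk D m p × Injective _≡_ _≡_ p

PathOfLength : (D : Digraph) → Vertex D → Vertex D → ℕ → Set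
PathOfLength D u v m =
  Σ (Fin (suc m) → Vertex D) λ p →
    IsPath D m p × (p Data.Fin.zero ≡ u) × (p (fromℕ m) ≡ v)

Dist : (D : Digraph) → Vertex D → Vertex D → ℕ → Set
Dist D u v m = PathOfLength D u v m × (∀ m' → m' < m → ¬ PathOfLength D u v m')

QuasiTransitive : ℕ → Digraph → Set
QuasiTransitive k D =
  (p : Fin (suc k) → Vertex D) → IsPath D k p →
  Arc D (p Data.Fin.zero) (p (fromℕ k)) ⊎ Arc D (p (fromℕ k)) (p Data.Fin.zero)

Odd Even : ℕ → Set
Odd m = ∃ λ j → m ≡ suc (2 * j)
Even m = ∃ λ j → m ≡ 2 * j

-- Write N = k + 2 and u_i for the vertices of P, and n = d(u₀, w). As P is a shortest u₀u_N path,
-- every u₀u_t path has length at least t; hence there is no arc u_i u_t with t > i + 1, and no arc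
-- w u_t with t > n + 1. Every arc xy below comes from k-quasi-transitivity applied to a path of
-- length exactly k from x to y whose reverse arc these bounds exclude: first u_k u₀ and u_N u₂, then
-- u_N u_s for every s with k − s odd (descending along u_N u_{s+2} … u_k u₀ … u_s), then u_{n+3} w
-- along u_{n+3} … u_N u₀ … w, and finally u_N w, which is u_N u_n when w = u_n and otherwise closes
-- a path of length k − 1 from u_N to u_{n+3} inside P.
module Submission where

open import Defs
open import Data.Nat using (ℕ; zero; suc; _+_; _*_; _∸_; _≤_; _<_; z≤n; s≤s)
open import Data.Nat.Properties
open import Data.Nat.Tactic.RingSolver using (solve-∀)
open import Data.Fin using (Fin; zero; suc; fromℕ; fromℕ<; toℕ; inject₁)
open import Data.Fin.Properties
  using (toℕ-injective; toℕ-fromℕ; toℕ-fromℕ<; toℕ-inject₁; toℕ≤pred[n]) renaming (_≟_ to _≟ᶠ_)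
open import Data.List using (List; []; _∷_; _++_; applyUpTo; tabulate)
open import Data.List.Membership.Propositional using (_∈_)
open import Data.List.Membership.Propositional.Properties using (∈-applyUpTo⁻; ∈-++⁻)
open import Data.List.Relation.Unary.Any using (here; there; any?)
open import Data.List.Relation.Unary.All using ([]; _∷_)
import Data.List.Relation.Unary.All as All
open import Data.List.Relation.Unary.All.Properties using (anti-mono)
open import Data.List.Relation.Unary.AllPairs using ([]; _∷_)
open import Data.List.Relation.Unary.Unique.Propositional using (Unique)
import Data.List.Relation.Unary.Unique.Propositional.Properties as Unique
open import Data.List.Relation.Binary.Disjoint.Propositional using (Disjoint)
open import Data.List.Relation.Binary.Subset.Propositional using (_⊆_)
open import Data.List.Relation.Binary.Subset.Propositional.Properties using (∷⁺ʳ)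
open import Data.Product using (Σ; ∃; _×_; _,_; proj₁; proj₂)
open import Data.Sum using (_⊎_; [_,_]′; fromInj₁; fromInj₂)
open import Data.Empty using (⊥; ⊥-elim)
open import Function using (_∘_; id)
open import Relation.Nullary using (¬_; yes; no)
open import Relation.Binary.PropositionalEquality

module Walks (D : Digraph) where

  private variable
    u x y z v : Vertex D
    k l m : ℕ

  infixr 5 _∷_
  infixr 4 _⟨_⟩_

  data Walk : Vertex D → Vertex D → ℕ → Set where
    []  : Walk x x 0
    _∷_ : Arc D x y → Walk y z l → Walk x z (suc l)

  vertices : Walk x y l → List (Vertex D)
  vertices {x = x} []      = x ∷ []
  vertices {x = x} (_ ∷ w) = x ∷ vertices w

  Simple : Walk x y l → Set
  Simple w = Unique (vertices w)

  _⟨_⟩_ : Walk x y m → Arc D y z → Walk z v l → Walk x v (m + suc l)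
  []      ⟨ a ⟩ q = a ∷ q
  (b ∷ p) ⟨ a ⟩ q = b ∷ (p ⟨ a ⟩ q)

  vertices-⟨⟩ : (p : Walk x y m) (a : Arc D y z) (q : Walk z v l) →
                vertices (p ⟨ a ⟩ q) ≡ vertices p ++ vertices q
  vertices-⟨⟩ []      a q = refl
  vertices-⟨⟩ (b ∷ p) a q = cong (_ ∷_) (vertices-⟨⟩ p a q)

  ⟨⟩-simple : (p : Walk x y m) (a : Arc D y z) (q : Walk z v l) → Simple p → Simple q →
              Disjoint (vertices p) (vertices q) → Simple (p ⟨ a ⟩ q)
  ⟨⟩-simple p a q sp sq disjoint =
    subst Unique (sym (vertices-⟨⟩ p a q)) (Unique.++⁺ sp sq disjoint)

  ∈-⟨⟩⁻ : (p : Walk x y m) (a : Arc D y z) (q : Walk z v l) →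
          u ∈ vertices (p ⟨ a ⟩ q) → u ∈ vertices p ⊎ u ∈ vertices q
  ∈-⟨⟩⁻ p a q = ∈-++⁻ (vertices p) ∘ subst (_ ∈_) (vertices-⟨⟩ p a q)

  prefix : (p : Walk x y l) → Simple p → v ∈ vertices p →
           Σ ℕ λ m → m ≤ l × Σ (Walk x v m) λ r → Simple r × vertices r ⊆ vertices p
  prefix []      _ (here refl) = 0 , z≤n , [] , [] ∷ [] , id
  prefix (_ ∷ p) _ (here refl) = 0 , z≤n , [] , [] ∷ [] , ∷⁺ʳ _ (λ ())
  prefix (a ∷ p) (x∉p ∷ sp) (there v∈p) =
    let m , m≤l , r , sr , r⊆p = prefix p sp v∈p
    in  suc m , s≤s m≤l , a ∷ r , anti-mono r⊆p x∉p ∷ sr , ∷⁺ʳ _ r⊆p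

  extend : (p : Walk x y l) → Simple p → Arc D y z →
           Σ ℕ λ m → m ≤ suc l × Σ (Walk x z m) Simple
  extend {l = l} {z = z} p sp a with any? (z ≟ᶠ_) (vertices p)
  ... | yes z∈p = let m , m≤l , r , sr , _ = prefix p sp z∈p in m , m≤n⇒m≤1+n m≤l , r , sr
  ... | no  z∉p = l + 1 , ≤-reflexive (+-comm l 1) , (p ⟨ a ⟩ []) ,
                  ⟨⟩-simple p a [] sp ([] ∷ [])
                    λ { (v∈p , here refl) → z∉p v∈p ; (_ , there ()) }

  trail : (f : ℕ → Vertex D) (l : ℕ) → (∀ {i} → i < l → Arc D (f i) (f (suc i))) →
          Walk (f 0) (f l) l
  trail f zero    _    = []
  trail f (suc l) arcs = arcs (s≤s z≤n) ∷ trail (f ∘ suc) l (λ i<l → arcs (s≤s i<l))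

  vertices-trail : ∀ f l {arcs : ∀ {i} → i < l → Arc D (f i) (f (suc i))} →
                    vertices (trail f l arcs) ≡ applyUpTo f (suc l)
  vertices-trail f zero    = refl
  vertices-trail f (suc l) = cong (f 0 ∷_) (vertices-trail (f ∘ suc) l)

  toFin : Walk x y l → Fin (suc l) → Vertex D
  toFin {x = x} _ zero    = x
  toFin (_ ∷ w)   (suc i) = toFin w i

  toFin-end : (w : Walk x y l) → toFin w (fromℕ l) ≡ y
  toFin-end []      = refl
  toFin-end (_ ∷ w) = toFin-end w

  toFin-walk : (w : Walk x y l) → IsWalk D l (toFin w)
  toFin-walk (a ∷ w) zero    = a
  toFin-walk (a ∷ w) (suc i) = toFin-walk w i

  toFin-∈ : (w : Walk x y l) (i : Fin (suc l)) → toFin w i ∈ vertices w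
  toFin-∈ []      zero    = here refl
  toFin-∈ (_ ∷ w) zero    = here refl
  toFin-∈ (_ ∷ w) (suc i) = there (toFin-∈ w i)

  toFin-injective : (w : Walk x y l) → Simple w → ∀ {i j} → toFin w i ≡ toFin w j → i ≡ j
  toFin-injective _       _          {zero}  {zero}  _  = refl
  toFin-injective (_ ∷ w) (x∉w ∷ _)  {zero}  {suc j} eq = ⊥-elim (All.lookup x∉w (toFin-∈ w j) eq)
  toFin-injective (_ ∷ w) (x∉w ∷ _)  {suc i} {zero}  eq =
    ⊥-elim (All.lookup x∉w (toFin-∈ w i) (sym eq))
  toFin-injective (_ ∷ w) (_ ∷ sw)   {suc i} {suc j} eq = cong suc (toFin-injective w sw eq)

  fromFin : (p : Fin (suc l) → Vertex D) → IsWalk D l p → Walk (p zero) (p (fromℕ l)) l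
  fromFin {l = zero}  p _  = []
  fromFin {l = suc l} p pw = pw zero ∷ fromFin (p ∘ suc) (λ i → pw (suc i))

  vertices-fromFin : (p : Fin (suc l) → Vertex D) (pw : IsWalk D l p) →
                     vertices (fromFin p pw) ≡ tabulate p
  vertices-fromFin {l = zero}  p pw = refl
  vertices-fromFin {l = suc l} p pw =
    cong (p zero ∷_) (vertices-fromFin (p ∘ suc) (λ i → pw (suc i)))

  walk⇒pathOfLength : (w : Walk x y l) → Simple w → PathOfLength D x y l
  walk⇒pathOfLength w sw = toFin w , (toFin-walk w , toFin-injective w sw) , refl , toFin-end w

  pathOfLength⇒walk : PathOfLength D x y l → Σ (Walk x y l) Simple
  pathOfLength⇒walk (p , (pw , p-injective) , refl , refl) =
    fromFin p pw , subst Unique (sym (vertices-fromFin p pw)) (Unique.tabulate⁺ p-injective)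

  qt-walk : QuasiTransitive k D → (w : Walk x y k) → Simple w → Arc D x y ⊎ Arc D y x
  qt-walk qt w sw with walk⇒pathOfLength w sw
  ... | p , p-path , refl , refl = qt p p-path

module ShortestPath (D : Digraph) (N : ℕ) (P : Fin (suc N) → Vertex D) (P-path : IsPath D N P)
                    (P-shortest : ∀ m → m < N → ¬ PathOfLength D (P zero) (P (fromℕ N)) m) where
  open Walks D

  private variable
    a b c i j m t : ℕ
    x y : Vertex D

  clamp : ℕ → Fin (suc N)
  clamp i = fromℕ< (s≤s (m⊓n≤n i N))

  toℕ-clamp : i ≤ N → toℕ (clamp i) ≡ i
  toℕ-clamp {i} i≤N = trans (toℕ-fromℕ< (s≤s (m⊓n≤n i N))) (m≤n⇒m⊓n≡m i≤N)

  -- The vertex u_i of the path; indices beyond N are clamped to N.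
  U : ℕ → Vertex D
  U i = P (clamp i)

  P≡U : (f : Fin (suc N)) → toℕ f ≡ i → P f ≡ U i
  P≡U f refl = cong P (toℕ-injective (sym (toℕ-clamp (toℕ≤pred[n] f))))

  U-arc : suc i ≤ N → Arc D (U i) (U (suc i))
  U-arc i<N = subst₂ (Arc D) (P≡U (inject₁ f) (trans (toℕ-inject₁ f) (toℕ-fromℕ< i<N)))
                             (P≡U (suc f) (cong suc (toℕ-fromℕ< i<N)))
                             (proj₁ P-path f)
    where f = fromℕ< i<N

  U-injective : i ≤ N → j ≤ N → U i ≡ U j → i ≡ j
  U-injective i≤N j≤N eq =
    trans (sym (toℕ-clamp i≤N)) (trans (cong toℕ (proj₂ P-path eq)) (toℕ-clamp j≤N))

  P-start : P zero ≡ U 0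
  P-start = P≡U zero refl

  P-end : P (fromℕ N) ≡ U N
  P-end = P≡U (fromℕ N) (toℕ-fromℕ N)

  path-from-start : PathOfLength D (P zero) y m → Σ (Walk (U 0) y m) Simple
  path-from-start = subst (λ x → Σ (Walk x _ _) Simple) P-start ∘ pathOfLength⇒walk

  path-to-start : (p : Walk (U 0) y m) → Simple p → PathOfLength D (P zero) y m
  path-to-start p sp = subst (λ x → PathOfLength D x _ _) (sym P-start) (walk⇒pathOfLength p sp)

  shortest : (p : Walk (U 0) (U N) m) → Simple p → N ≤ m
  shortest p sp = ≮⇒≥ λ m<N →
    P-shortest _ m<N (subst (λ y → PathOfLength D (P zero) y _) (sym P-end) (path-to-start p sp))

  -- Downward induction on t: a u₀u_t path shorter than t followed by the arc u_t u_{t+1}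
  -- shortcuts to a u₀u_{t+1} path shorter than t + 1, until t = N contradicts minimality.
  distance-lower : (p : Walk (U 0) (U t) j) → Simple p → t ≤ N → t ≤ j
  distance-lower {t} p sp t≤N = go (N ∸ t) (m∸n+n≡m t≤N) p sp
    where
    go : ∀ g {t j} → g + t ≡ N → (p : Walk (U 0) (U t) j) → Simple p → t ≤ j
    go zero    refl p sp = shortest p sp
    go (suc g) {t} g+t≡N p sp =
      let m , m≤1+j , r , sr = extend p sp (U-arc (subst (suc t ≤_) g+t≡N (s≤s (m≤n+m t g))))
      in  ≤-pred (≤-trans (go g (trans (+-suc g t) g+t≡N) r sr) m≤1+j)

  ∈-walk-bound : (p : Walk (U 0) y j) → Simple p → U t ∈ vertices p → t ≤ N → t ≤ j
  ∈-walk-bound p sp Ut∈p t≤N =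
    let m , m≤j , r , sr , _ = prefix p sp Ut∈p in ≤-trans (distance-lower r sr t≤N) m≤j

  arc-bound : (p : Walk (U 0) y j) → Simple p → Arc D y (U t) → t ≤ N → t ≤ suc j
  arc-bound p sp a t≤N =
    let m , m≤1+j , r , sr = extend p sp a in ≤-trans (distance-lower r sr t≤N) m≤1+j

  OnSegment : ℕ → ℕ → Vertex D → Set
  OnSegment a b x = ∃ λ t → a ≤ t × t ≤ b × x ≡ U t

  widen : a ≤ b → c ≤ j → OnSegment b c x → OnSegment a j x
  widen a≤b c≤j (t , b≤t , t≤c , refl) = t , ≤-trans a≤b b≤t , ≤-trans t≤c c≤j , refl

  separated : b < c → j ≤ N → OnSegment a b x → OnSegment c j x → ⊥
  separated b<c j≤N (t , _ , t≤b , refl) (t′ , c≤t′ , t′≤j , Ut≡Ut′) =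
    <-irrefl (U-injective (≤-trans (<⇒≤ t<t′) t′≤N) t′≤N Ut≡Ut′) t<t′
    where
    t<t′ = <-≤-trans (≤-<-trans t≤b b<c) c≤t′
    t′≤N = ≤-trans t′≤j j≤N

  record PathWithin (lo hi : ℕ) (x y : Vertex D) (m : ℕ) : Set where
    field
      walk   : Walk x y m
      simple : Simple walk
      along  : ∀ {v} → v ∈ vertices walk → OnSegment lo hi v
  open PathWithin public

  segment : ∀ a l → l + a ≡ b → b ≤ N → PathWithin a b (U a) (U b) l
  segment a l refl b≤N = record
    { walk   = trail f l λ i<l → U-arc (≤-trans (+-monoˡ-≤ a i<l) b≤N)
    ; simple = subst Unique (sym (vertices-trail f l)) (Unique.applyUpTo⁺₁ f (suc l) distinct)
    ; along  = λ v∈ →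
        let i , i≤l , v≡ = ∈-applyUpTo⁻ f (subst (_ ∈_) (vertices-trail f l) v∈)
        in  i + a , m≤n+m a i , +-monoˡ-≤ a (≤-pred i≤l) , v≡
    }
    where
    f = λ i → U (i + a)
    distinct : i < j → j < suc l → f i ≢ f j
    distinct i<j j≤l eq = <-irrefl (+-cancelʳ-≡ _ _ _ (U-injective i+a≤N j+a≤N eq)) i<j
      where
      j+a≤N = ≤-trans (+-monoˡ-≤ a (≤-pred j≤l)) b≤N
      i+a≤N = ≤-trans (+-monoˡ-≤ a (<⇒≤ i<j)) j+a≤N

  initial : t ≤ N → PathWithin 0 t (U 0) (U t) t
  initial {t} = segment 0 t (+-identityʳ t)

  dist-to-U : Dist D (P zero) (U t) m → t ≤ N → m ≡ t
  dist-to-U {t} (path , minimal) t≤N =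
    let p , sp = path-from-start path
        s      = initial t≤N
    in  ≤-antisym (≮⇒≥ λ t<m → minimal t t<m (path-to-start (walk s) (simple s)))
                  (distance-lower p sp t≤N)

  no-skip : suc i < t → t ≤ N → ¬ Arc D (U i) (U t)
  no-skip {i} i+1<t t≤N a = <⇒≱ i+1<t (arc-bound (walk s) (simple s) a t≤N)
    where s = initial (≤-trans (<⇒≤ (<-trans (n<1+n i) i+1<t)) t≤N)

  from-end : Arc D (U N) (U c) → ∀ l → l + c ≡ b → b < N → PathWithin c N (U N) (U b) (suc l)
  from-end {c} a l eq b<N = record
    { walk   = a ∷ walk s
    ; simple = ⟨⟩-simple [] a (walk s) ([] ∷ []) (simple s) disjoint
    ; along  = λ { (here refl)  → N , c≤N , ≤-refl , refl
                 ; (there v∈s) → widen ≤-refl b≤N (along s v∈s) }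
    }
    where
    b≤N = <⇒≤ b<N
    c≤N = ≤-trans (m≤n+m c l) (subst (_≤ N) (sym eq) b≤N)
    s   = segment c l eq b≤N
    disjoint : Disjoint (U N ∷ []) (vertices (walk s))
    disjoint (here refl , v∈s) =
      separated b<N ≤-refl (along s v∈s) (N , ≤-refl , ≤-refl , refl)
    disjoint (there () , _)

module QuasiTransitiveShortestPath
  (k : ℕ) (3≤k : 3 ≤ k) (D : Digraph) (qt : QuasiTransitive k D)
  (P : Fin (suc (k + 2)) → Vertex D) (P-path : IsPath D (k + 2) P)
  (P-dist : Dist D (P zero) (P (fromℕ (k + 2))) (k + 2)) where
  open Walks D
  open ShortestPath D (k + 2) P P-path (proj₂ P-dist) public

  private variable
    c e i lo m : ℕ
    x y : Vertex D

  N : ℕ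
  N = k + 2

  qt-forward : (p : Walk x y m) → Simple p → m ≡ k → ¬ Arc D y x → Arc D x y
  qt-forward p sp refl ¬back = fromInj₁ (⊥-elim ∘ ¬back) (qt-walk qt p sp)

  qt-backward : (p : Walk x y m) → Simple p → m ≡ k → ¬ Arc D x y → Arc D y x
  qt-backward p sp refl ¬forth = fromInj₂ (⊥-elim ∘ ¬forth) (qt-walk qt p sp)

  ≤k⇒<N : i ≤ k → suc i < N
  ≤k⇒<N i≤k = ≤-trans (s≤s (s≤s i≤k)) (≤-reflexive (+-comm 2 k))

  k<N : k < N
  k<N = m<m+n k (s≤s z≤n)

  arc-k-0 : Arc D (U k) (U 0)
  arc-k-0 = qt-backward (walk s) (simple s) refl (no-skip (<⇒≤ 3≤k) (<⇒≤ k<N))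
    where s = initial (<⇒≤ k<N)

  end-arc-2 : Arc D (U N) (U 2)
  end-arc-2 = qt-backward (walk s) (simple s) refl (no-skip (≤k⇒<N (<⇒≤ 3≤k)) ≤-refl)
    where s = segment 2 k refl ≤-refl

  from-end-wrapping : Arc D (U N) (U c) → ∀ l → l + c ≡ k → e < c →
                      PathWithin 0 N (U N) (U e) (suc l + suc e)
  from-end-wrapping {c} {e} a l eq e<c = record
    { walk   = walk r ⟨ arc-k-0 ⟩ walk s
    ; simple = ⟨⟩-simple (walk r) arc-k-0 (walk s) (simple r) (simple s) disjoint
    ; along  = λ v∈ → [ widen z≤n ≤-refl ∘ along r , widen ≤-refl e≤N ∘ along s ]′
                        (∈-⟨⟩⁻ (walk r) arc-k-0 (walk s) v∈)
    }
    where
    r   = from-end a l eq k<N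
    e≤N = ≤-trans (<⇒≤ e<c) (≤-trans (m≤n+m c l) (subst (_≤ N) (sym eq) (<⇒≤ k<N)))
    s   = initial e≤N
    disjoint : Disjoint (vertices (walk r)) (vertices (walk s))
    disjoint (v∈r , v∈s) = separated e<c ≤-refl (along s v∈s) (along r v∈r)

  end-arc : PathWithin lo N (U N) (U e) m → m ≡ k → e ≤ k → Arc D (U N) (U e)
  end-arc r m≡k e≤k = qt-forward (walk r) (simple r) m≡k (no-skip (≤k⇒<N e≤k) ≤-refl)

  end-arc-step : ∀ s l → l + (s + 2) ≡ k → Arc D (U N) (U (s + 2)) → Arc D (U N) (U s)
  end-arc-step s l eq a =
    end-arc (from-end-wrapping a l eq (m<m+n s (s≤s z≤n))) (trans (length s l) eq) s≤k
    where
    length : ∀ s l → suc l + suc s ≡ l + (s + 2)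
    length = solve-∀
    s≤k = ≤-trans (m≤m+n s 2) (subst (s + 2 ≤_) eq (m≤n+m (s + 2) l))

  end-arc-0 : Arc D (U N) (U 0)
  end-arc-0 = end-arc-step 0 (k ∸ 2) (m∸n+n≡m (<⇒≤ 3≤k)) end-arc-2

  end-arc-odd-gap : ∀ d s → s + 2 * d + 1 ≡ k → Arc D (U N) (U s)
  end-arc-odd-gap zero s eq =
    end-arc (from-end end-arc-0 s (+-identityʳ s) (≤-trans (s≤s s≤k) k<N))
            (trans (length s) eq) s≤k
    where
    length : ∀ s → suc s ≡ s + 2 * 0 + 1
    length = solve-∀
    s≤k = subst (s ≤_) (trans (length s) eq) (n≤1+n s)
  end-arc-odd-gap (suc d) s eq =
    end-arc-step s (suc (2 * d)) (trans (wrap s d) eq) (end-arc-odd-gap d (s + 2) (trans (shift s d) eq))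
    where
    wrap : ∀ s d → suc (2 * d) + (s + 2) ≡ s + 2 * suc d + 1
    wrap = solve-∀
    shift : ∀ s d → s + 2 + 2 * d + 1 ≡ s + 2 * suc d + 1
    shift = solve-∀

  module EvenDistance (w : Vertex D) (n : ℕ) (w-dist : Dist D (P zero) w n) (n<k : n < k) where

    q : Walk (U 0) w n
    q = proj₁ (path-from-start (proj₁ w-dist))

    q-simple : Simple q
    q-simple = proj₂ (path-from-start (proj₁ w-dist))

    no-arc-w-end : ¬ Arc D w (U N)
    no-arc-w-end a = <⇒≱ (≤k⇒<N (<⇒≤ n<k)) (arc-bound q q-simple a ≤-refl)

    arc-3+n-w : ∀ d → n + 2 * d + 1 ≡ k → Arc D (U (3 + n)) w
    arc-3+n-w d eq = qt-forward (walk s ⟨ end-arc-0 ⟩ q) simple-path (trans (length n d) eq) back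
      where
      reach : ∀ n d → 2 * d + (3 + n) ≡ n + 2 * d + 1 + 2
      reach = solve-∀
      length : ∀ n d → 2 * d + suc n ≡ n + 2 * d + 1
      length = solve-∀
      reach-N = trans (reach n d) (cong (_+ 2) eq)
      s = segment (3 + n) (2 * d) reach-N ≤-refl
      disjoint : Disjoint (vertices (walk s)) (vertices q)
      disjoint (v∈s , v∈q) with t , 3+n≤t , t≤N , refl ← along s v∈s
        = <⇒≱ (≤-trans (m≤n+m (suc n) 2) 3+n≤t) (∈-walk-bound q q-simple v∈q t≤N)
      simple-path = ⟨⟩-simple (walk s) end-arc-0 q (simple s) q-simple disjoint
      back : ¬ Arc D w (U (3 + n))
      back a = <⇒≱ (n≤1+n (suc (suc n))) (arc-bound q q-simple a 3+n≤N)
        where 3+n≤N = subst (3 + n ≤_) reach-N (m≤n+m (3 + n) (2 * d))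

    module OffPath (w≢Uₙ : w ≢ U n) where

      off-P : OnSegment lo N x → x ≢ w
      off-P (t , _ , t≤N , refl) Ut≡w = w≢Uₙ (trans (sym Ut≡w) (cong U (sym n≡t)))
        where n≡t = dist-to-U (subst (λ y → Dist D (P zero) y n) (sym Ut≡w) w-dist) t≤N

      end-arc-w : PathWithin lo N (U N) y m → Arc D y w → m + 1 ≡ k → Arc D (U N) w
      end-arc-w r a len = qt-forward (walk r ⟨ a ⟩ []) simple-path len no-arc-w-end
        where
        simple-path = ⟨⟩-simple (walk r) a [] (simple r) ([] ∷ [])
                        λ { (v∈r , here refl) → off-P (along r v∈r) refl ; (_ , there ()) }

      -- With k = n + 2d + 1, the path from u_N to u_{n+3} closed by the arc to w is
      -- u_N u_2 … u_{n+3} for d = 1, u_N u_0 … u_{n+3} for d = 2, and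
      -- u_N u_{n+6} … u_k u_0 … u_{n+3} for d ≥ 3; for d = 0 already u_{n+3} = u_N.
      end-arc-w-off-P : ∀ d → n + 2 * d + 1 ≡ k → Arc D (U N) w
      end-arc-w-off-P zero eq =
        subst (λ i → Arc D (U i) w) (trans (reach n) (cong (_+ 2) eq)) (arc-3+n-w 0 eq)
        where
        reach : ∀ n → 3 + n ≡ n + 2 * 0 + 1 + 2
        reach = solve-∀
      end-arc-w-off-P 1 eq =
        end-arc-w (from-end end-arc-2 (suc n) (+-comm (suc n) 2) (≤k⇒<N 2+n≤k))
                  (arc-3+n-w 1 eq) (trans (length n) eq)
        where
        length : ∀ n → suc (suc n) + 1 ≡ n + 2 * 1 + 1
        length = solve-∀
        2+n≤k = subst (2 + n ≤_) (trans (length n) eq) (m≤m+n (2 + n) 1)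
      end-arc-w-off-P 2 eq =
        end-arc-w (from-end end-arc-0 (3 + n) (+-identityʳ (3 + n)) (≤k⇒<N 2+n≤k))
                  (arc-3+n-w 2 eq) (trans (length n) eq)
        where
        length : ∀ n → suc (3 + n) + 1 ≡ n + 2 * 2 + 1
        length = solve-∀
        2+n≤k = subst (2 + n ≤_) (trans (length n) eq)
                  (≤-trans (m≤n+m (2 + n) 2) (m≤m+n (4 + n) 1))
      end-arc-w-off-P (suc (suc (suc d))) eq =
        end-arc-w (from-end-wrapping (end-arc-odd-gap d (6 + n) (trans (gap n d) eq)) (suc (2 * d))
                                     (trans (wrap n d) eq) (m<n+m (3 + n) {3} (s≤s z≤n)))
                  (arc-3+n-w (3 + d) eq) (trans (length n d) eq)
        where
        gap : ∀ n d → 6 + n + 2 * d + 1 ≡ n + 2 * (3 + d) + 1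
        gap = solve-∀
        wrap : ∀ n d → suc (2 * d) + (6 + n) ≡ n + 2 * (3 + d) + 1
        wrap = solve-∀
        length : ∀ n d → suc (suc (2 * d)) + suc (3 + n) + 1 ≡ n + 2 * (3 + d) + 1
        length = solve-∀

    end-arc-w : ∀ d → n + 2 * d + 1 ≡ k → Arc D (U N) w
    end-arc-w d eq with w ≟ᶠ U n
    ... | yes w≡Uₙ = subst (Arc D (U N)) (sym w≡Uₙ) (end-arc-odd-gap d n eq)
    ... | no  w≢Uₙ = OffPath.end-arc-w-off-P w≢Uₙ d eq

odd-minus-even : ∀ {n k} → Even n → Odd k → n < k → ∃ λ d → n + 2 * d + 1 ≡ k
odd-minus-even (i , refl) (j , refl) (s≤s 2i≤2j) = j ∸ i , (begin
  2 * i + 2 * (j ∸ i) + 1     ≡⟨ cong (λ x → 2 * i + x + 1) (*-distribˡ-∸ 2 j i) ⟩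
  2 * i + (2 * j ∸ 2 * i) + 1 ≡⟨ cong (_+ 1) (m+[n∸m]≡n 2i≤2j) ⟩
  2 * j + 1                   ≡⟨ +-comm (2 * j) 1 ⟩
  suc (2 * j)                 ∎)
  where open ≡-Reasoning

mainTheorem20 : (k : ℕ) → 3 ≤ k → Odd k →
    (D : Digraph) → QuasiTransitive k D →
    (P : Fin (suc (k + 2)) → Vertex D) → IsPath D (k + 2) P →
    Dist D (P zero) (P (fromℕ (k + 2))) (k + 2) →
    (w : Vertex D) (m : ℕ) → Dist D (P zero) w m → Even m → suc m ≤ k →
    Arc D (P (fromℕ (k + 2))) w
mainTheorem20 k 3≤k k-odd D qt P P-path P-dist w m w-dist m-even m<k =
  let d , eq = odd-minus-even m-even k-odd m<k
  in  subst (λ x → Arc D x w) (sym P-end) (end-arc-w d eq)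
  where
  open QuasiTransitiveShortestPath k 3≤k D qt P P-path P-dist
  open EvenDistance w m w-dist m<k
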